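{- Let $\mathcal{S}_R,\mathcal{S}_P,\mathcal{S}_Q\in\mathcal{L}(n)$ with atoms $\{a_1\},\dots,\{a_n\}$, where $\mathcal{S}_R$ is super-atomic, $\mathcal{S}_Q\prec\mathcal{S}_P\le\mathcal{S}_R$ in $\mathcal{L}(n)$, and the labeling $\mathcal{C}_P$ of $\mathcal{S}_P$ is a strong coordinatization. Then the labeling $\mathcal{C}_Q$ of $\mathcal{S}_Q$ is a strong coordinatization if and only if $\triangle_Q(\{a_k\})=x_Q(\{a_k\})$ for every $k\in\{1,\dots,n\}$.
   Context: $\mathcal{L}(n)$ is the set of finite atomic lattices with $n$ labeled atoms, each represented as a family $\mathcal{S}_T$ of subsets of $\{a_1,\dots,a_n\}$ closed under intersection and containing $\emptyset$, $\{a_1,\dots,a_n\}$ and all singletons $\{a_i\}$, ordered by inclusion (joins are the smallest members containing the union). $\mathcal{L}(n)$ is partially ordered by: $\mathcal{S}_Q\le\mathcal{S}_P$ iff there is a join-preserving map $\mathcal{S}_P\to\mathcal{S}_Q$ which is a bijection on atoms respecting labels; $\prec$ denotes the covering relation. A finite atomic lattice is super-atomic if for every element $p$ that is neither the bottom nor an atom, and every set $T$ of atoms with $\bigvee T=p$, there exist exactly two elements $a,b\in T$ with $a\vee b=p$. For $\mathcal{S}_T\in\mathcal{L}(n)$ the labeling $\mathcal{C}_T$ assigns to each $C\in\mathcal{S}_T\setminus\{\emptyset\}$ the monomial $m_C=\prod_{a_i\in C}a_i$ in $K[a_1,\dots,a_n]$ ($K$ a field), and $m_\emptyset=1$. For an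 atom $\{a_i\}$ let $x_T(\{a_i\})=\prod_{C\in\mathcal{S}_T,\ \{a_i\}\not\subseteq C}m_C$, and let $C_{\mathcal{S}_T,\mathcal{C}_T}$ be the ideal generated by all $x_T(\{a_i\})$. For $D\in\mathcal{S}_T$ let $B_D$ be the set of sets $W$ of atoms contained in $D$ whose join in $\mathcal{S}_T$ is $D$, and let $\triangle_T(\{a_i\})=\gcd\{\mathrm{lcm}\{x_T(w):w\in W\}: W\in\bigcup_{D\supseteq\{a_i\}}B_D\}$ (with $\mathrm{lcm}\,\emptyset=\gcd\emptyset=1$). The lcm-lattice $LCM(I)$ of a monomial ideal is the set of least common multiples of subsets of its minimal generators, ordered by divisibility. $\mathcal{C}_T$ is a strong coordinatization of $\mathcal{S}_T$ if there is a lattice isomorphism $g:\mathcal{S}_T\to LCM(C_{\mathcal{S}_T,\mathcal{C}_T})$ with $g(\{a_i\})=x_T(\{a_i\})$ for all $i$. -}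

module Defs where

open import Data.Nat using (ℕ; zero; suc; _≤_; _⊔_; _⊓_)
open import Data.Bool using (Bool; true; false; _∧_; _∨_; not; if_then_else_)
open import Data.Fin using (Fin)
open import Data.Fin.Subset using (Subset; ⊥; ⊤; ⁅_⁆; _∩_; _∪_; _∈_; _⊆_)
open import Data.Fin.Subset.Properties using (_⊆?_)
open import Data.Vec using (Vec; []; _∷_; lookup; tabulate; zipWith; replicate)
open import Data.List using (List; []; _∷_; map; _++_; foldr; filterᵇ; allFin)
open import Data.Nat.ListAction using (sum)
open import Data.Bool.ListAction using (all; any)
open import Data.List.Relation.Unary.All using (All)
open import Data.Product using (Σ; _×_; _,_)
open import Data.Sum using (_⊎_)
open import Relation.Nullary using (¬_)
open import Relation.Nullary.Decidable using (⌊_⌋)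
open import Relation.Binary.PropositionalEquality using (_≡_; _≢_)
open import Function.Bundles using (_⇔_)

-- Families of subsets of the atom set {a_1,…,a_n} (atoms = Fin n).
-- A family is given by its (decidable) membership function.

Family : ℕ → Set
Family n = Subset n → Bool

_∈F_ : ∀ {n} → Subset n → Family n → Set
C ∈F S = S C ≡ true

allSubsets : ∀ n → List (Subset n)
allSubsets zero = [] ∷ []
allSubsets (suc n) = map (true ∷_) (allSubsets n) ++ map (false ∷_) (allSubsets n)

isLub? : ∀ {n} → Family n → Subset n → Subset n → Bool
isLub? {n} S X D =
  S D ∧ ⌊ X ⊆? D ⌋ ∧
  all (λ E → not (S E ∧ ⌊ X ⊆? E ⌋) ∨ ⌊ D ⊆? E ⌋) (allSubsets n)

-- D is the join in S of the set of atoms X (equivalently of the elements A,B when X = A ∪ B)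
IsJoin : ∀ {n} → Family n → Subset n → Subset n → Set
IsJoin S X D = isLub? S X D ≡ true

-- S ∈ L(n): closed under ∩, contains ∅, the full set and all singletons
IsAtomicLattice : ∀ {n} → Family n → Set
IsAtomicLattice {n} S =
  (⊥ ∈F S) × (⊤ ∈F S) × (∀ (i : Fin n) → ⁅ i ⁆ ∈F S) ×
  (∀ A B → A ∈F S → B ∈F S → (A ∩ B) ∈F S)

SameFam : ∀ {n} → Family n → Family n → Set
SameFam {n} P Q = ∀ (C : Subset n) → P C ≡ Q C

_≤L_ : ∀ {n} → Family n → Family n → Set
_≤L_ {n} Q P = Σ (Subset n → Subset n) λ f →
  (∀ C → C ∈F P → f C ∈F Q) ×
  (∀ (i : Fin n) → f ⁅ i ⁆ ≡ ⁅ i ⁆) ×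
  (∀ A B D → A ∈F P → B ∈F P → IsJoin P (A ∪ B) D → IsJoin Q (f A ∪ f B) (f D))

_≺L_ : ∀ {n} → Family n → Family n → Set
_≺L_ {n} Q P = (Q ≤L P) × ¬ SameFam Q P ×
  (∀ (T : Family n) → IsAtomicLattice T → Q ≤L T → T ≤L P → SameFam T Q ⊎ SameFam T P)

SuperAtomic : ∀ {n} → Family n → Set
SuperAtomic {n} S = ∀ (p : Subset n) → p ∈F S → p ≢ ⊥ → (∀ (i : Fin n) → p ≢ ⁅ i ⁆) →
  ∀ (T : Subset n) → IsJoin S T p →
  Σ (Fin n) λ a → Σ (Fin n) λ b → a ∈ T × b ∈ T × IsJoin S (⁅ a ⁆ ∪ ⁅ b ⁆) p ×
    (∀ c d → c ∈ T → d ∈ T → IsJoin S (⁅ c ⁆ ∪ ⁅ d ⁆) p →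
       (c ≡ a × d ≡ b) ⊎ (c ≡ b × d ≡ a))

-- Monomials in K[a_1,…,a_n], represented by their exponent vectors.

Mono : ℕ → Set
Mono n = Vec ℕ n

one : ∀ {n} → Mono n
one = replicate _ 0

_∣M_ : ∀ {n} → Mono n → Mono n → Set
_∣M_ {n} m m' = ∀ (j : Fin n) → lookup m j ≤ lookup m' j

lcmM : ∀ {n} → Mono n → Mono n → Mono n
lcmM = zipWith _⊔_

gcdM : ∀ {n} → Mono n → Mono n → Mono n
gcdM = zipWith _⊓_

lcmList : ∀ {n} → List (Mono n) → Mono n
lcmList = foldr lcmM one

gcdList : ∀ {n} → List (Mono n) → Mono n
gcdList [] = one
gcdList (m ∷ ms) = foldr gcdM m ms

-- x_T({a_i}) = ∏_{C ∈ S, a_i ∉ C} m_C : exponent of a_j counts such C containing a_j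
x : ∀ {n} → Family n → Fin n → Mono n
x {n} S i = tabulate λ j →
  sum (map (λ C → if S C ∧ not (lookup C i) ∧ lookup C j then 1 else 0) (allSubsets n))

elems : ∀ {n} → Subset n → List (Fin n)
elems {n} W = filterᵇ (lookup W) (allFin n)

-- △_T({a_i}) = gcd { lcm{x_T(w) : w ∈ W} : W ∈ ⋃_{D ∈ S, a_i ∈ D} B_D }
triangle : ∀ {n} → Family n → Fin n → Mono n
triangle {n} S i = gcdList (map (λ W → lcmList (map (x S) (elems W)))
  (filterᵇ (λ W → any (λ D → isLub? S W D ∧ lookup D i) (allSubsets n)) (allSubsets n)))

-- the monomial ideal C_{S,C_S} generated by the x_S({a_i})
InIdeal : ∀ {n} → Family n → Mono n → Set
InIdeal {n} S m = Σ (Fin n) λ j → x S j ∣M m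

MinGen : ∀ {n} → Family n → Mono n → Set
MinGen {n} S m = InIdeal S m × (∀ m' → InIdeal S m' → m' ∣M m → m' ≡ m)

InLCM : ∀ {n} → Family n → Mono n → Set
InLCM {n} S m = Σ (List (Mono n)) λ ms → All (MinGen S) ms × m ≡ lcmList ms

StrongCoord : ∀ {n} → Family n → Set
StrongCoord {n} S = Σ (Subset n → Mono n) λ g →
  (∀ C → C ∈F S → InLCM S (g C)) ×
  (∀ m → InLCM S m → Σ (Subset n) λ C → C ∈F S × g C ≡ m) ×
  (∀ A B → A ∈F S → B ∈F S → g A ≡ g B → A ≡ B) ×
  (∀ A B → A ∈F S → B ∈F S → (A ⊆ B ⇔ g A ∣M g B)) ×
  (∀ (i : Fin n) → g ⁅ i ⁆ ≡ x S i)

-- Write g(C) = lcm {x_Q({a_i}) : a_i ∈ C}. The hypotheses on R and P are only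
-- used to show that the atom labels of Q separate members: if a_k ∉ B ∈ S_Q
-- then x_Q({a_k}) ∤ g(B). Indeed S_Q ⊆ S_P ⊆ S_R as families, and super-atomicity
-- of S_R writes B ∨ {a_k} as {a_j} ∨ {a_k} for some a_j ∈ B; every member of S_Q
-- containing a_j but not a_b (b ∈ B) then also avoids a_k, while B itself is such
-- a member avoiding a_k, so a_j has a strictly larger exponent in x_Q({a_k}) than
-- in every x_Q({a_b}). (If B = ∅ any atom a_j ≠ a_k does; one exists as S_Q ≠ S_P.)
-- Given separation, the x_Q({a_i}) are the minimal generators and g reflects
-- inclusion, so g is a strong coordinatization as soon as it is onto LCM, i.e.
-- as soon as g(⋁W) = g(W) for every set W of atoms: this is △_Q = x_Q.
-- Conversely a strong coordinatization forces x_Q({a_k}) ∣ g(W) whenever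
-- a_k ∈ ⋁W, which together with W = {a_k} gives △_Q({a_k}) = x_Q({a_k}).
module Submission where

open import Defs
open import Data.Nat using (ℕ; zero; suc; _≤_; _<_; _⊔_; _⊓_; z≤n; s≤s)
open import Data.Nat.Properties
  using (≤-refl; ≤-trans; ≤-antisym; ≤-<-trans; <-irrefl; +-mono-≤; +-mono-≤-<;
         ⊔-lub; m≤m⊔n; m≤n⊔m; ⊔-assoc; ⊔-identityˡ; ⊓-glb; m⊓n≤m; m⊓n≤n)
open import Data.Nat.ListAction using (sum)
open import Data.Bool using (Bool; true; false; _∧_; _∨_; not; if_then_else_; T; T?)
open import Data.Bool.Properties using (T-≡; T-∧; ∧-zeroʳ) renaming (_≟_ to _≟ᵇ_)
open import Data.Bool.ListAction using (any; all)
open import Data.Fin using (Fin; zero; suc; _≟_)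
open import Data.Fin.Subset using (Subset; ⊥; ⁅_⁆; _∪_; _∈_; _∉_; _⊆_; ⋃; ⋂; Nonempty)
open import Data.Fin.Subset.Properties
  using (_⊆?_; _∈?_; ⊆-refl; ⊆-trans; ⊆-antisym; ⊆-reflexive; x∈p∪q⁻; p⊆p∪q; q⊆p∪q;
         x∈p∩q⁺; x∈p∩q⁻; ∈⊤; ∉⊥; x∈⁅x⁆; x∈⁅y⁆⇒x≡y; x≢y⇒x∉⁅y⁆; nonempty?; Empty-unique;
         ∪-identityʳ)
open import Data.Vec using ([]; _∷_; lookup)
open import Data.Vec.Properties
  using (lookup-zipWith; lookup-replicate; lookup∘tabulate; []=⇒lookup; lookup⇒[]=;
         zipWith-assoc; zipWith-identityˡ)
open import Data.Vec.Relation.Binary.Pointwise.Extensional using (ext; Pointwise-≡⇒≡)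
open import Data.List using (List; []; _∷_; map; _++_; filter; filterᵇ; allFin)
open import Data.List.Membership.Propositional using (lose) renaming (_∈_ to _∈ˡ_)
open import Data.List.Membership.Propositional.Properties
  using (∈-map⁺; ∈-map⁻; ∈-++⁺ˡ; ∈-++⁺ʳ; ∈-filter⁺; ∈-filter⁻; ∈-allFin)
open import Data.List.Relation.Unary.Any using (here; there; satisfied)
open import Data.List.Relation.Unary.Any.Properties using (any⁺; any⁻)
open import Data.List.Relation.Unary.All as All using (All; []; _∷_)
open import Data.List.Relation.Unary.All.Properties using (all⁺; all⁻; map⁺; ++⁺)
open import Data.Product using (Σ; ∃-syntax; _×_; _,_; proj₁; proj₂)
open import Data.Sum using (_⊎_; inj₁; inj₂; [_,_])
import Data.Sum as Sum
open import Data.Empty using (⊥-elim)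
open import Data.Unit using (tt)
open import Function using (_∘_)
open import Function.Bundles using (_⇔_; mk⇔; Equivalence)
open import Relation.Nullary using (¬_; Dec; yes; no; contradiction)
open import Relation.Nullary.Decidable using (⌊_⌋; _×-dec_; toWitness; fromWitness)
open import Relation.Binary.PropositionalEquality
  using (_≡_; _≢_; refl; sym; trans; cong; subst; ≢-sym; module ≡-Reasoning)

private
  variable
    n : ℕ
    S : Family n
    A B C D D′ E W X Y : Subset n
    b i j k : Fin n
    m t : Mono n
    ms : List (Mono n)

-- Divisibility of monomials

∣M-refl : m ∣M m
∣M-refl _ = ≤-refl

∣M-trans : {a b c : Mono n} → a ∣M b → b ∣M c → a ∣M c
∣M-trans a∣b b∣c j = ≤-trans (a∣b j) (b∣c j)

∣M-antisym : {a b : Mono n} → a ∣M b → b ∣M a → a ≡ b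
∣M-antisym a∣b b∣a = Pointwise-≡⇒≡ (ext λ j → ≤-antisym (a∣b j) (b∣a j))

lookup-lcmM : ∀ (a b : Mono n) j → lookup (lcmM a b) j ≡ lookup a j ⊔ lookup b j
lookup-lcmM a b j = lookup-zipWith _⊔_ j a b

lcmList-upper : m ∈ˡ ms → m ∣M lcmList ms
lcmList-upper {ms = a ∷ ms} (here refl) j rewrite lookup-lcmM a (lcmList ms) j = m≤m⊔n _ _
lcmList-upper {ms = a ∷ ms} (there m∈ms) j rewrite lookup-lcmM a (lcmList ms) j =
  ≤-trans (lcmList-upper m∈ms j) (m≤n⊔m _ _)

module _ {A : Set} (f : A → Mono n) where

  lcmList-map-least : ∀ xs t → (∀ {a} → a ∈ˡ xs → f a ∣M t) → lcmList (map f xs) ∣M t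
  lcmList-map-least [] t _ j rewrite lookup-replicate j 0 = z≤n
  lcmList-map-least (a ∷ xs) t xs∣t j rewrite lookup-lcmM (f a) (lcmList (map f xs)) j =
    ⊔-lub (xs∣t (here refl) j) (lcmList-map-least xs t (λ a∈xs → xs∣t (there a∈xs)) j)

  lcmList-map-lookup-< : ∀ xs j {t} → 0 < t → (∀ {a} → a ∈ˡ xs → lookup (f a) j < t) →
                         lookup (lcmList (map f xs)) j < t
  lcmList-map-lookup-< [] j 0<t _ rewrite lookup-replicate j 0 = 0<t
  lcmList-map-lookup-< (a ∷ xs) j 0<t xs<t rewrite lookup-lcmM (f a) (lcmList (map f xs)) j =
    ⊔-lub (xs<t (here refl)) (lcmList-map-lookup-< xs j 0<t (λ a∈xs → xs<t (there a∈xs)))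

lcmList-++ : ∀ (ms ms′ : List (Mono n)) → lcmList (ms ++ ms′) ≡ lcmM (lcmList ms) (lcmList ms′)
lcmList-++ [] ms′ = sym (zipWith-identityˡ ⊔-identityˡ (lcmList ms′))
lcmList-++ (m ∷ ms) ms′ =
  trans (cong (lcmM m) (lcmList-++ ms ms′)) (sym (zipWith-assoc ⊔-assoc m _ _))

lookup-gcdM : ∀ (a b : Mono n) j → lookup (gcdM a b) j ≡ lookup a j ⊓ lookup b j
lookup-gcdM a b j = lookup-zipWith _⊓_ j a b

gcdList-lower : m ∈ˡ ms → gcdList ms ∣M m
gcdList-lower {ms = a ∷ ms} = lower a ms
  where
  lower : ∀ {m} a ms → m ∈ˡ a ∷ ms → gcdList (a ∷ ms) ∣M m
  lower a [] (here refl) = ∣M-refl {m = a}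
  lower a (b ∷ ms) (there (here refl)) j rewrite lookup-gcdM b (gcdList (a ∷ ms)) j =
    m⊓n≤m _ _
  lower a (b ∷ ms) (here refl) j rewrite lookup-gcdM b (gcdList (a ∷ ms)) j =
    ≤-trans (m⊓n≤n _ _) (lower a ms (here refl) j)
  lower a (b ∷ ms) (there (there m∈ms)) j rewrite lookup-gcdM b (gcdList (a ∷ ms)) j =
    ≤-trans (m⊓n≤n _ _) (lower a ms (there m∈ms) j)

-- The member m₀ only rules out ms = [], where gcdList returns the junk value 1.
gcdList-greatest : ∀ {m₀} → m₀ ∈ˡ ms → (∀ {m} → m ∈ˡ ms → t ∣M m) → t ∣M gcdList ms
gcdList-greatest {ms = a ∷ ms} {t} _ = greatest a ms
  where
  greatest : ∀ a ms → (∀ {m} → m ∈ˡ a ∷ ms → t ∣M m) → t ∣M gcdList (a ∷ ms)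
  greatest a [] t∣ms = t∣ms (here refl)
  greatest a (b ∷ ms) t∣ms j rewrite lookup-gcdM b (gcdList (a ∷ ms)) j =
    ⊓-glb (t∣ms (there (here refl)) j) (greatest a ms t∣a∷ms j)
    where
    t∣a∷ms : ∀ {m} → m ∈ˡ a ∷ ms → t ∣M m
    t∣a∷ms (here refl) = t∣ms (here refl)
    t∣a∷ms (there m∈ms) = t∣ms (there (there m∈ms))

countᵇ : {A : Set} → (A → Bool) → List A → ℕ
countᵇ p xs = sum (map (λ c → if p c then 1 else 0) xs)

private
  indicator-mono : ∀ {a b} → (a ≡ true → b ≡ true) → (if a then 1 else 0) ≤ (if b then 1 else 0)
  indicator-mono {false} _ = z≤n
  indicator-mono {true} a⇒b rewrite a⇒b refl = ≤-refl

module _ {A : Set} {p q : A → Bool} (p⇒q : ∀ c → p c ≡ true → q c ≡ true) where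

  countᵇ-mono : ∀ xs → countᵇ p xs ≤ countᵇ q xs
  countᵇ-mono [] = z≤n
  countᵇ-mono (c ∷ xs) = +-mono-≤ (indicator-mono (p⇒q c)) (countᵇ-mono xs)

  countᵇ-< : ∀ {c xs} → c ∈ˡ xs → p c ≡ false → q c ≡ true → countᵇ p xs < countᵇ q xs
  countᵇ-< {xs = _ ∷ xs} (here refl) pc qc rewrite pc | qc = s≤s (countᵇ-mono xs)
  countᵇ-< {xs = c′ ∷ _} (there c∈xs) pc qc =
    +-mono-≤-< (indicator-mono (p⇒q c′)) (countᵇ-< c∈xs pc qc)

-- Subsets and joins

allSubsets-complete : ∀ (C : Subset n) → C ∈ˡ allSubsets n
allSubsets-complete [] = here refl
allSubsets-complete {suc n} (true ∷ C) = ∈-++⁺ˡ (∈-map⁺ (true ∷_) (allSubsets-complete C))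
allSubsets-complete {suc n} (false ∷ C) =
  ∈-++⁺ʳ (map (true ∷_) (allSubsets n)) (∈-map⁺ (false ∷_) (allSubsets-complete C))

∈⇒T : i ∈ C → T (lookup C i)
∈⇒T = Equivalence.from T-≡ ∘ []=⇒lookup

T⇒∈ : T (lookup C i) → i ∈ C
T⇒∈ {C = C} {i} = lookup⇒[]= i C ∘ Equivalence.to T-≡

∉⇒lookup≡false : i ∉ C → lookup C i ≡ false
∉⇒lookup≡false {i = i} {C} i∉C with lookup C i in eq
... | true = contradiction (lookup⇒[]= i C eq) i∉C
... | false = refl

∈-elems⁺ : i ∈ C → i ∈ˡ elems C
∈-elems⁺ {i = i} {C} i∈C = ∈-filter⁺ (T? ∘ lookup C) (∈-allFin i) (∈⇒T i∈C)

∈-elems⁻ : i ∈ˡ elems C → i ∈ C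
∈-elems⁻ {n} {C = C} = T⇒∈ ∘ proj₂ ∘ ∈-filter⁻ (T? ∘ lookup C) {xs = allFin n}

⁅⁆⊆ : i ∈ C → ⁅ i ⁆ ⊆ C
⁅⁆⊆ {i = i} {C} i∈C j∈⁅i⁆ = subst (_∈ C) (sym (x∈⁅y⁆⇒x≡y i j∈⁅i⁆)) i∈C

∪-least : A ⊆ C → B ⊆ C → A ∪ B ⊆ C
∪-least {A = A} {B = B} A⊆C B⊆C = [ A⊆C , B⊆C ] ∘ x∈p∪q⁻ A B

⋃⁅_⁆ : List (Fin n) → Subset n
⋃⁅ is ⁆ = ⋃ (map ⁅_⁆ is)

∈-⋃⁅⁆⁺ : ∀ {is} → i ∈ˡ is → i ∈ ⋃⁅ is ⁆
∈-⋃⁅⁆⁺ {i = i} (here refl) = p⊆p∪q _ (x∈⁅x⁆ i)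
∈-⋃⁅⁆⁺ (there i∈is) = q⊆p∪q _ _ (∈-⋃⁅⁆⁺ i∈is)

∈-⋃⁅⁆⁻ : ∀ is → i ∈ ⋃⁅ is ⁆ → i ∈ˡ is
∈-⋃⁅⁆⁻ [] i∈⊥ = contradiction i∈⊥ ∉⊥
∈-⋃⁅⁆⁻ (i′ ∷ is) i∈ with x∈p∪q⁻ ⁅ i′ ⁆ ⋃⁅ is ⁆ i∈
... | inj₁ i∈⁅i′⁆ = here (x∈⁅y⁆⇒x≡y i′ i∈⁅i′⁆)
... | inj₂ i∈⋃ = there (∈-⋃⁅⁆⁻ is i∈⋃)

⋃⁅elems⁆ : ⋃⁅ elems C ⁆ ≡ C
⋃⁅elems⁆ {C = C} = ⊆-antisym (∈-elems⁻ ∘ ∈-⋃⁅⁆⁻ (elems C)) (∈-⋃⁅⁆⁺ ∘ ∈-elems⁺)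

∈-⋂⁺ : ∀ {Es : List (Subset n)} → (∀ {E} → E ∈ˡ Es → i ∈ E) → i ∈ ⋂ Es
∈-⋂⁺ {Es = []} _ = ∈⊤
∈-⋂⁺ {Es = E ∷ Es} i∈Es = x∈p∩q⁺ (i∈Es (here refl) , ∈-⋂⁺ (i∈Es ∘ there))

∈-⋂⁻ : ∀ {Es : List (Subset n)} → E ∈ˡ Es → i ∈ ⋂ Es → i ∈ E
∈-⋂⁻ {Es = E ∷ Es} (here refl) i∈⋂ = proj₁ (x∈p∩q⁻ E (⋂ Es) i∈⋂)
∈-⋂⁻ {Es = E′ ∷ Es} (there E∈Es) i∈⋂ = ∈-⋂⁻ E∈Es (proj₂ (x∈p∩q⁻ E′ (⋂ Es) i∈⋂))

_⊆F_ : Family n → Family n → Set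
S ⊆F S′ = ∀ {C} → C ∈F S → C ∈F S′

⊥∈ : IsAtomicLattice S → ⊥ ∈F S
⊥∈ (⊥∈S , _) = ⊥∈S

atom∈ : IsAtomicLattice S → ∀ i → ⁅ i ⁆ ∈F S
atom∈ (_ , _ , atoms∈S , _) = atoms∈S

record Join (S : Family n) (X D : Subset n) : Set where
  field
    join∈ : D ∈F S
    upper : X ⊆ D
    least : ∀ {E} → E ∈F S → X ⊆ E → D ⊆ E
open Join

-- The last conjunct of isLub?, for one candidate E.
private
  least-clause⇔ : T (not (S E ∧ ⌊ X ⊆? E ⌋) ∨ ⌊ D ⊆? E ⌋) ⇔ (E ∈F S → X ⊆ E → D ⊆ E)
  least-clause⇔ {S = S} {E} {X} {D} = mk⇔ to from
    where
    to : T (not (S E ∧ ⌊ X ⊆? E ⌋) ∨ ⌊ D ⊆? E ⌋) → E ∈F S → X ⊆ E → D ⊆ E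
    to t E∈S X⊆E with S E | E∈S | X ⊆? E
    ... | .true | refl | yes _ = toWitness t
    ... | .true | refl | no X⊈E = ⊥-elim (X⊈E X⊆E)
    from : (E ∈F S → X ⊆ E → D ⊆ E) → T (not (S E ∧ ⌊ X ⊆? E ⌋) ∨ ⌊ D ⊆? E ⌋)
    from D⊆E with S E | X ⊆? E
    ... | true | yes X⊆E = fromWitness {a? = D ⊆? E} (D⊆E refl X⊆E)
    ... | true | no _ = tt
    ... | false | _ = tt

isJoin⇒Join : IsJoin S X D → Join S X D
isJoin⇒Join {n} {S} {X} {D} isJoin with S D in D∈S | X ⊆? D
... | true | yes X⊆D = record
  { join∈ = D∈S
  ; upper = X⊆D
  ; least = λ {E} → Equivalence.to (least-clause⇔ {S = S} {E} {X} {D})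
      (All.lookup (all⁺ _ (allSubsets n) (Equivalence.from T-≡ isJoin)) (allSubsets-complete E))
  }

Join⇒isJoin : Join S X D → IsJoin S X D
Join⇒isJoin {n} {S} {X} {D} j rewrite join∈ j with X ⊆? D
... | yes _ = Equivalence.to T-≡ (all⁻ _ {xs = allSubsets n} (All.tabulate λ {E} _ →
  Equivalence.from (least-clause⇔ {S = S} {E} {X} {D}) (least j)))
... | no X⊈D = ⊥-elim (X⊈D (upper j))

join-unique : Join S X D → Join S X D′ → D ≡ D′
join-unique j j′ = ⊆-antisym (least j (join∈ j′) (upper j′)) (least j′ (join∈ j) (upper j))

join-of-member : D ∈F S → X ⊆ D → D ⊆ X → Join S X D
join-of-member D∈S X⊆D D⊆X = record { join∈ = D∈S ; upper = X⊆D ; least = λ _ X⊆E → ⊆-trans D⊆X X⊆E }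

join-∪-join : Join S Y E → Join S (X ∪ Y) D → Join S (X ∪ E) D
join-∪-join {X = X} jY jXY = record
  { join∈ = join∈ jXY
  ; upper = ∪-least (upper jXY ∘ p⊆p∪q _) (least jY (join∈ jXY) (upper jXY ∘ q⊆p∪q X _))
  ; least = λ F∈S X∪E⊆F → least jXY F∈S (∪-least (X∪E⊆F ∘ p⊆p∪q _) (X∪E⊆F ∘ q⊆p∪q X _ ∘ upper jY))
  }

join₂-least : ∀ {a b p} → Join S (⁅ a ⁆ ∪ ⁅ b ⁆) p → C ∈F S → a ∈ C → b ∈ C → p ⊆ C
join₂-least a∨b C∈S a∈C b∈C = least a∨b C∈S (∪-least (⁅⁆⊆ a∈C) (⁅⁆⊆ b∈C))

closure : Family n → Subset n → Subset n
closure {n} S X = ⋂ (filter (λ E → (S E ≟ᵇ true) ×-dec (X ⊆? E)) (allSubsets n))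

closure-Join : IsAtomicLattice S → ∀ X → Join S X (closure S X)
closure-Join {n} {S} latS X = record
  { join∈ = ⋂-∈F (λ E∈ → proj₁ (proj₂ (∈-filter⁻ upper? {xs = allSubsets n} E∈)))
  ; upper = λ i∈X → ∈-⋂⁺ λ E∈ → proj₂ (proj₂ (∈-filter⁻ upper? {xs = allSubsets n} E∈)) i∈X
  ; least = λ E∈S X⊆E → ∈-⋂⁻ (∈-filter⁺ upper? (allSubsets-complete _) (E∈S , X⊆E))
  }
  where
  upper? : ∀ E → Dec (E ∈F S × X ⊆ E)
  upper? E = (S E ≟ᵇ true) ×-dec (X ⊆? E)
  ⋂-∈F : ∀ {Es} → (∀ {E} → E ∈ˡ Es → E ∈F S) → ⋂ Es ∈F S
  ⋂-∈F {[]} _ = proj₁ (proj₂ latS)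
  ⋂-∈F {E ∷ Es} Es⊆S = proj₂ (proj₂ (proj₂ latS)) E (⋂ Es) (Es⊆S (here refl)) (⋂-∈F (Es⊆S ∘ there))

-- Comparable lattices

module _ {P Q : Family n} (latP : IsAtomicLattice P) (Q≤P : Q ≤L P) where

  private
    f : Subset n → Subset n
    f = proj₁ Q≤P

    f-atom : ∀ i → f ⁅ i ⁆ ≡ ⁅ i ⁆
    f-atom = proj₁ (proj₂ (proj₂ Q≤P))

    f-Join : A ∈F P → B ∈F P → Join P (A ∪ B) E → Join Q (f A ∪ f B) (f E)
    f-Join {A = A} {B} {E} A∈P B∈P A∨B =
      isJoin⇒Join (proj₂ (proj₂ (proj₂ Q≤P)) A B E A∈P B∈P (Join⇒isJoin A∨B))

    ⊆f : A ∈F P → A ⊆ f A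
    ⊆f {A = A} A∈P {j} j∈A = upper (f-Join (atom∈ latP j) A∈P ⁅j⁆∨A) (p⊆p∪q _ j∈f⁅j⁆)
      where
      ⁅j⁆∨A : Join P (⁅ j ⁆ ∪ A) A
      ⁅j⁆∨A = join-of-member A∈P (∪-least (⁅⁆⊆ j∈A) ⊆-refl) (q⊆p∪q _ _)
      j∈f⁅j⁆ : j ∈ f ⁅ j ⁆
      j∈f⁅j⁆ = subst (j ∈_) (sym (f-atom j)) (x∈⁅x⁆ j)

    f-join⊆ : D ∈F Q → ∀ j js → ⋃⁅ j ∷ js ⁆ ⊆ D → Join P ⋃⁅ j ∷ js ⁆ E → f E ⊆ D
    f-join⊆ {D = D} D∈Q j [] X⊆D X∨ =
      subst (λ E → f E ⊆ D) (join-unique ⁅j⁆∨ X∨) (subst (_⊆ D) (sym (f-atom j)) (X⊆D ∘ p⊆p∪q _))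
      where
      ⁅j⁆∨ : Join P ⋃⁅ j ∷ [] ⁆ ⁅ j ⁆
      ⁅j⁆∨ = join-of-member (atom∈ latP j) (⊆-reflexive (∪-identityʳ _)) (p⊆p∪q _)
    f-join⊆ {D = D} D∈Q j (j′ ∷ js) X⊆D X∨ =
      least (f-Join (atom∈ latP j) (join∈ Y∨) (join-∪-join Y∨ X∨)) D∈Q
        (∪-least (subst (_⊆ D) (sym (f-atom j)) (X⊆D ∘ p⊆p∪q _))
                 (f-join⊆ D∈Q j′ js (X⊆D ∘ q⊆p∪q _ _) Y∨))
      where
      Y∨ : Join P ⋃⁅ j′ ∷ js ⁆ (closure P ⋃⁅ j′ ∷ js ⁆)
      Y∨ = closure-Join latP ⋃⁅ j′ ∷ js ⁆

  -- For i ∈ D, the join E in P of the atoms of D satisfies D ⊆ E ⊆ f E ⊆ D.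
  ≤L⇒⊆F : Q ⊆F P
  ≤L⇒⊆F {D} D∈Q with nonempty? D
  ... | no D-empty = subst (_∈F P) (sym (Empty-unique D-empty)) (⊥∈ latP)
  ... | yes (i , i∈D) =
    subst (_∈F P) (⊆-antisym closure⊆D (⊆-trans D⊆atoms (upper atoms∨))) (join∈ atoms∨)
    where
    atoms : Subset n
    atoms = ⋃⁅ i ∷ elems D ⁆
    atoms∨ : Join P atoms (closure P atoms)
    atoms∨ = closure-Join latP atoms
    D⊆atoms : D ⊆ atoms
    D⊆atoms = q⊆p∪q _ _ ∘ subst (_ ∈_) (sym ⋃⁅elems⁆)
    closure⊆D : closure P atoms ⊆ D
    closure⊆D =
      f-join⊆ D∈Q i (elems D) (∪-least (⁅⁆⊆ i∈D) (⊆-reflexive ⋃⁅elems⁆)) atoms∨ ∘ ⊆f (join∈ atoms∨)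

one-atom-SameFam : ∀ {P Q : Family 1} → IsAtomicLattice P → IsAtomicLattice Q → SameFam Q P
one-atom-SameFam latP latQ (false ∷ []) = trans (⊥∈ latQ) (sym (⊥∈ latP))
one-atom-SameFam latP latQ (true ∷ []) = trans (atom∈ latQ zero) (sym (atom∈ latP zero))

another-atom : ∀ {P Q : Family n} → IsAtomicLattice P → IsAtomicLattice Q → ¬ SameFam Q P →
               ∀ (k : Fin n) → ∃[ j ] j ≢ k
another-atom {suc zero} latP latQ Q≠P zero = ⊥-elim (Q≠P (one-atom-SameFam latP latQ))
another-atom {suc (suc n)} _ _ _ zero = suc zero , λ ()
another-atom {suc (suc n)} _ _ _ (suc k) = zero , λ ()

-- Atom labels and their lcm

-- C is one of the factors m_C of x_S({a_i}), and it contains a_j.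
xFactor : Family n → Fin n → Fin n → Subset n → Bool
xFactor S i j C = S C ∧ not (lookup C i) ∧ lookup C j

x-exponent : ∀ (S : Family n) i j → lookup (x S i) j ≡ countᵇ (xFactor S i j) (allSubsets n)
x-exponent S i j = lookup∘tabulate _ j

xFactor⁺ : C ∈F S → i ∉ C → j ∈ C → xFactor S i j C ≡ true
xFactor⁺ {i = i} {j = j} C∈S i∉C j∈C rewrite C∈S | ∉⇒lookup≡false i∉C | []=⇒lookup j∈C = refl

xFactor⁻ : xFactor S i j C ≡ true → C ∈F S × i ∉ C × j ∈ C
xFactor⁻ {S = S} {i} {j} {C} factor with S C in C∈S | lookup C i in Ci | lookup C j in Cj
... | true | false | true =
  refl , (λ i∈C → contradiction (trans (sym ([]=⇒lookup i∈C)) Ci) λ ()) , lookup⇒[]= j C Cj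

xFactor-∈ : i ∈ C → xFactor S i j C ≡ false
xFactor-∈ {C = C} {S = S} i∈C rewrite []=⇒lookup i∈C = ∧-zeroʳ (S C)

x-exponent-pos : ⁅ j ⁆ ∈F S → j ≢ k → 0 < lookup (x S k) j
x-exponent-pos {j = j} {S = S} {k} j∈S j≢k rewrite x-exponent S k j =
  ≤-<-trans z≤n (countᵇ-< (λ _ ()) (allSubsets-complete ⁅ j ⁆) refl
                  (xFactor⁺ {S = S} j∈S (x≢y⇒x∉⁅y⁆ (≢-sym j≢k)) (x∈⁅x⁆ j)))

lcmx : Family n → Subset n → Mono n
lcmx S C = lcmList (map (x S) (elems C))

module _ (S : Family n) where

  x∣lcmx : i ∈ C → x S i ∣M lcmx S C
  x∣lcmx i∈C = lcmList-upper (∈-map⁺ (x S) (∈-elems⁺ i∈C))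

  lcmx-least : ∀ C t → (∀ {i} → i ∈ C → x S i ∣M t) → lcmx S C ∣M t
  lcmx-least C t C∣t = lcmList-map-least (x S) (elems C) t (C∣t ∘ ∈-elems⁻)

  lcmx-mono : ∀ {A B} → A ⊆ B → lcmx S A ∣M lcmx S B
  lcmx-mono {A} {B} A⊆B = lcmx-least A (lcmx S B) (x∣lcmx ∘ A⊆B)

  lcmx-⁅⁆ : ∀ i → lcmx S ⁅ i ⁆ ≡ x S i
  lcmx-⁅⁆ i = ∣M-antisym {a = lcmx S ⁅ i ⁆} (lcmx-least ⁅ i ⁆ (x S i) x∣xi) (x∣lcmx (x∈⁅x⁆ i))
    where
    x∣xi : ∀ {j} → j ∈ ⁅ i ⁆ → x S j ∣M x S i
    x∣xi j∈⁅i⁆ rewrite x∈⁅y⁆⇒x≡y i j∈⁅i⁆ = ∣M-refl {m = x S i}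

  lcmx-atoms : ∀ is → lcmx S ⋃⁅ is ⁆ ≡ lcmList (map (x S) is)
  lcmx-atoms is = ∣M-antisym {a = lcmx S ⋃⁅ is ⁆}
    (lcmx-least ⋃⁅ is ⁆ (lcmList (map (x S) is)) (lcmList-upper ∘ ∈-map⁺ (x S) ∘ ∈-⋃⁅⁆⁻ is))
    (lcmList-map-least (x S) is (lcmx S ⋃⁅ is ⁆) (x∣lcmx ∘ ∈-⋃⁅⁆⁺))

  lcmx-lookup-< : ∀ C j {t} → 0 < t → (∀ {b} → b ∈ C → lookup (x S b) j < t) →
                  lookup (lcmx S C) j < t
  lcmx-lookup-< C j 0<t C<t = lcmList-map-lookup-< (x S) (elems C) j 0<t (C<t ∘ ∈-elems⁻)

InLCM-lcmList : All (InLCM S) ms → InLCM S (lcmList ms)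
InLCM-lcmList [] = [] , [] , refl
InLCM-lcmList {S = S} ((gs , gs-min , refl) ∷ ms-in) with InLCM-lcmList {S = S} ms-in
... | hs , hs-min , eq = gs ++ hs , ++⁺ gs-min hs-min ,
  trans (cong (lcmM (lcmList gs)) eq) (sym (lcmList-++ gs hs))

-- △ as a gcd

-- The sets W of atoms over which △_S({a_k}) takes its gcd: those whose join contains a_k.
spans : Family n → Fin n → Subset n → Bool
spans {n} S k W = any (λ D → isLub? S W D ∧ lookup D k) (allSubsets n)

∈-spans⁺ : Join S W D → k ∈ D → W ∈ˡ filterᵇ (spans S k) (allSubsets n)
∈-spans⁺ {S = S} {W} {D} {k} W∨D k∈D = ∈-filter⁺ (T? ∘ spans S k) (allSubsets-complete W)
  (any⁺ _ (lose (allSubsets-complete D)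
    (Equivalence.from T-∧ (Equivalence.from T-≡ (Join⇒isJoin W∨D) , ∈⇒T k∈D))))

∈-spans⁻ : W ∈ˡ filterᵇ (spans S k) (allSubsets n) → ∃[ D ] Join S W D × k ∈ D
∈-spans⁻ {n} {W} {S} {k} W∈
  with satisfied (any⁻ _ (allSubsets n) (proj₂ (∈-filter⁻ (T? ∘ spans S k) {xs = allSubsets n} W∈)))
... | D , W∨D×k∈D with Equivalence.to T-∧ W∨D×k∈D
... | W∨D , k∈D = D , isJoin⇒Join (Equivalence.to T-≡ W∨D) , T⇒∈ k∈D

triangle∣lcmx : Join S W D → k ∈ D → triangle S k ∣M lcmx S W
triangle∣lcmx {S = S} W∨D k∈D = gcdList-lower (∈-map⁺ (lcmx S) (∈-spans⁺ W∨D k∈D))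

∣triangle : ⁅ k ⁆ ∈F S → (∀ {W D} → Join S W D → k ∈ D → t ∣M lcmx S W) → t ∣M triangle S k
∣triangle {k = k} {S} {t} k∈S t∣spanning =
  gcdList-greatest {t = t} (∈-map⁺ (lcmx S) (∈-spans⁺ ⁅k⁆∨ (x∈⁅x⁆ k))) t∣m
  where
  ⁅k⁆∨ : Join S ⁅ k ⁆ ⁅ k ⁆
  ⁅k⁆∨ = join-of-member {S = S} k∈S ⊆-refl ⊆-refl
  t∣m : ∀ {m} → m ∈ˡ map (lcmx S) (filterᵇ (spans S k) (allSubsets _)) → t ∣M m
  t∣m m∈ with ∈-map⁻ (lcmx S) m∈
  ... | W , W∈ , refl with ∈-spans⁻ W∈
  ... | D , W∨D , k∈D = t∣spanning W∨D k∈D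

-- Separation of atoms by their labels

XSeparating : Family n → Set
XSeparating {n} S = ∀ {B : Subset n} {k} → B ∈F S → k ∉ B → ¬ (x S k ∣M lcmx S B)

x∤lcmx : ⁅ j ⁆ ∈F S → j ≢ k → (∀ {b} → b ∈ B → lookup (x S b) j < lookup (x S k) j) →
         ¬ (x S k ∣M lcmx S B)
x∤lcmx {j = j} {S} {k} {B} j∈S j≢k B<k xk∣lcmx =
  <-irrefl refl (≤-<-trans (xk∣lcmx j) (lcmx-lookup-< S B j (x-exponent-pos {S = S} j∈S j≢k) B<k))

x-exponent-< : B ∈F S → k ∉ B → j ∈ B → (∀ {C} → C ∈F S → j ∈ C → k ∈ C → B ⊆ C) →
               b ∈ B → lookup (x S b) j < lookup (x S k) j
x-exponent-< {B = B} {S} {k} {j} {b} B∈S k∉B j∈B jk⇒B b∈B rewrite x-exponent S b j | x-exponent S k j =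
  countᵇ-< b-factor⇒k-factor (allSubsets-complete B)
    (xFactor-∈ {S = S} b∈B) (xFactor⁺ {S = S} B∈S k∉B j∈B)
  where
  b-factor⇒k-factor : ∀ C → xFactor S b j C ≡ true → xFactor S k j C ≡ true
  b-factor⇒k-factor C factor with xFactor⁻ {S = S} factor
  ... | C∈S , b∉C , j∈C = xFactor⁺ {S = S} C∈S (λ k∈C → b∉C (jk⇒B C∈S j∈C k∈C b∈B)) j∈C

-- B ∨ {a_k} = {a_j} ∨ {a_k} for some atom a_j of B.
superAtomic-pairing : ∀ {R : Family n} → IsAtomicLattice R → SuperAtomic R →
                      B ∈F R → k ∉ B → Nonempty B →
                      ∃[ j ] j ∈ B × (∀ {C} → C ∈F R → j ∈ C → k ∈ C → B ⊆ C)
superAtomic-pairing {n} {B} {k} {R} latR saR B∈R k∉B (b₀ , b₀∈B) =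
  let (a , b , a∈ , b∈ , a∨b , _) = saR p (join∈ p-join) p≢⊥ p≢atom (B ∪ ⁅ k ⁆) (Join⇒isJoin p-join)
  in from-pair (isJoin⇒Join a∨b) (in-B-or-k a∈) (in-B-or-k b∈)
  where
  p : Subset n
  p = closure R (B ∪ ⁅ k ⁆)
  p-join : Join R (B ∪ ⁅ k ⁆) p
  p-join = closure-Join latR (B ∪ ⁅ k ⁆)
  B⊆p : B ⊆ p
  B⊆p = upper p-join ∘ p⊆p∪q _
  k∈p : k ∈ p
  k∈p = upper p-join (q⊆p∪q B _ (x∈⁅x⁆ k))
  b₀∈p : b₀ ∈ p
  b₀∈p = B⊆p b₀∈B
  p≢⊥ : p ≢ ⊥
  p≢⊥ p≡⊥ = ∉⊥ (subst (k ∈_) p≡⊥ k∈p)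
  p≢atom : ∀ i → p ≢ ⁅ i ⁆
  p≢atom i p≡⁅i⁆ = k∉B (subst (_∈ B) (trans (is-i b₀∈p) (sym (is-i k∈p))) b₀∈B)
    where
    is-i : ∀ {j} → j ∈ p → j ≡ i
    is-i j∈p = x∈⁅y⁆⇒x≡y i (subst (_ ∈_) p≡⁅i⁆ j∈p)
  in-B-or-k : i ∈ B ∪ ⁅ k ⁆ → i ∈ B ⊎ i ≡ k
  in-B-or-k i∈ = Sum.map₂ (x∈⁅y⁆⇒x≡y k) (x∈p∪q⁻ B ⁅ k ⁆ i∈)
  from-pair : ∀ {a b} → Join R (⁅ a ⁆ ∪ ⁅ b ⁆) p → a ∈ B ⊎ a ≡ k → b ∈ B ⊎ b ≡ k →
              ∃[ j ] j ∈ B × (∀ {C} → C ∈F R → j ∈ C → k ∈ C → B ⊆ C)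
  from-pair a∨b (inj₁ a∈B) (inj₁ b∈B) = ⊥-elim (k∉B (join₂-least a∨b B∈R a∈B b∈B k∈p))
  from-pair a∨b (inj₂ refl) (inj₂ refl) =
    ⊥-elim (k∉B (subst (_∈ B) (x∈⁅y⁆⇒x≡y k b₀∈⁅k⁆) b₀∈B))
    where
    b₀∈⁅k⁆ : b₀ ∈ ⁅ k ⁆
    b₀∈⁅k⁆ = join₂-least a∨b (atom∈ latR k) (x∈⁅x⁆ k) (x∈⁅x⁆ k) b₀∈p
  from-pair {a} a∨b (inj₁ a∈B) (inj₂ refl) =
    a , a∈B , λ C∈R a∈C k∈C → ⊆-trans B⊆p (join₂-least a∨b C∈R a∈C k∈C)
  from-pair {b = b} a∨b (inj₂ refl) (inj₁ b∈B) =
    b , b∈B , λ C∈R b∈C k∈C → ⊆-trans B⊆p (join₂-least a∨b C∈R k∈C b∈C)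

superAtomic⇒XSeparating : ∀ {R Q : Family n} → IsAtomicLattice R → SuperAtomic R → Q ⊆F R →
                          (∀ i → ⁅ i ⁆ ∈F Q) → (∀ k → ∃[ j ] j ≢ k) → XSeparating Q
superAtomic⇒XSeparating {Q = Q} latR saR Q⊆R atoms∈Q another {B} {k} B∈Q k∉B with nonempty? B
... | yes B≠∅ =
  let (j , j∈B , jk⇒B) = superAtomic-pairing latR saR (Q⊆R B∈Q) k∉B B≠∅
  in x∤lcmx {S = Q} (atoms∈Q j) (λ j≡k → k∉B (subst (_∈ B) j≡k j∈B))
       (x-exponent-< {S = Q} B∈Q k∉B j∈B (λ C∈Q → jk⇒B (Q⊆R C∈Q)))
... | no B=∅ =
  let (j , j≢k) = another k
  in x∤lcmx {S = Q} (atoms∈Q j) j≢k (λ b∈B → ⊥-elim (B=∅ (_ , b∈B)))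

lcmx-join : (∀ k → triangle S k ≡ x S k) → Join S W D → lcmx S D ≡ lcmx S W
lcmx-join {S = S} {W = W} {D} triangle≡x W∨D = ∣M-antisym {a = lcmx S D}
  (lcmx-least S D (lcmx S W) λ {i} i∈D → subst (_∣M lcmx S W) (triangle≡x i) (triangle∣lcmx W∨D i∈D))
  (lcmx-mono S (upper W∨D))

MinGen⇒x : MinGen S m → ∃[ j ] m ≡ x S j
MinGen⇒x {S = S} ((j , xj∣m) , minimal) = j , sym (minimal (x S j) (j , ∣M-refl {m = x S j}) xj∣m)

MinGens⇒xs : All (MinGen S) ms → ∃[ is ] ms ≡ map (x S) is
MinGens⇒xs [] = [] , refl
MinGens⇒xs {S = S} (m-min ∷ ms-min) with MinGen⇒x {S = S} m-min | MinGens⇒xs {S = S} ms-min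
... | j , refl | is , refl = j ∷ is , refl

strongCoord⇒triangle≡x : (∀ i → ⁅ i ⁆ ∈F S) → StrongCoord S → ∀ k → triangle S k ≡ x S k
strongCoord⇒triangle≡x {S = S} atoms∈S (g , g∈LCM , g-onto , _ , g-order , g-atom) k =
  ∣M-antisym {a = triangle S k}
    (subst (triangle S k ∣M_) (lcmx-⁅⁆ S k)
      (triangle∣lcmx (join-of-member {S = S} (atoms∈S k) ⊆-refl ⊆-refl) (x∈⁅x⁆ k)))
    (∣triangle {t = x S k} (atoms∈S k) x∣spanning)
  where
  ∈⇔x∣g : C ∈F S → (i ∈ C ⇔ x S i ∣M g C)
  ∈⇔x∣g {C} {i} C∈S = mk⇔
    (λ i∈C → subst (_∣M g C) (g-atom i) (Equivalence.to ⁅i⁆⊆C⇔ (⁅⁆⊆ i∈C)))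
    (λ xi∣gC → Equivalence.from ⁅i⁆⊆C⇔ (subst (_∣M g C) (sym (g-atom i)) xi∣gC) (x∈⁅x⁆ i))
    where
    ⁅i⁆⊆C⇔ : ⁅ i ⁆ ⊆ C ⇔ g ⁅ i ⁆ ∣M g C
    ⁅i⁆⊆C⇔ = g-order ⁅ i ⁆ C (atoms∈S i) C∈S

  lcmx∈LCM : ∀ W → InLCM S (lcmx S W)
  lcmx∈LCM W = InLCM-lcmList {S = S}
    (map⁺ (All.universal (λ i → subst (InLCM S) (g-atom i) (g∈LCM ⁅ i ⁆ (atoms∈S i))) (elems W)))

  x∣spanning : ∀ {W D} → Join S W D → k ∈ D → x S k ∣M lcmx S W
  x∣spanning {W} W∨D k∈D with g-onto (lcmx S W) (lcmx∈LCM W)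
  ... | C , C∈S , gC≡lcmx =
    subst (x S k ∣M_) gC≡lcmx (Equivalence.to (∈⇔x∣g C∈S) (least W∨D C∈S W⊆C k∈D))
    where
    W⊆C : W ⊆ C
    W⊆C w∈W = Equivalence.from (∈⇔x∣g C∈S) (subst (x S _ ∣M_) (sym gC≡lcmx) (x∣lcmx S w∈W))

module _ {S : Family n} (latS : IsAtomicLattice S) (separating : XSeparating S) where

  x-MinGen : ∀ i → MinGen S (x S i)
  x-MinGen i = (i , ∣M-refl {m = x S i}) , minimal
    where
    minimal : ∀ m → InIdeal S m → m ∣M x S i → m ≡ x S i
    minimal m (j , xj∣m) m∣xi with j ≟ i
    ... | yes refl = ∣M-antisym {a = m} m∣xi xj∣m
    ... | no j≢i = ⊥-elim (separating (atom∈ latS i) (x≢y⇒x∉⁅y⁆ j≢i)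
                    (subst (x S j ∣M_) (sym (lcmx-⁅⁆ S i)) (∣M-trans {a = x S j} {m} {x S i} xj∣m m∣xi)))

  lcmx-reflects-⊆ : B ∈F S → lcmx S A ∣M lcmx S B → A ⊆ B
  lcmx-reflects-⊆ {B} {A} B∈S A∣B {i} i∈A with i ∈? B
  ... | yes i∈B = i∈B
  ... | no i∉B =
    ⊥-elim (separating B∈S i∉B (∣M-trans {a = x S i} {lcmx S A} {lcmx S B} (x∣lcmx S i∈A) A∣B))

  triangle≡x⇒strongCoord : (∀ k → triangle S k ≡ x S k) → StrongCoord S
  triangle≡x⇒strongCoord triangle≡x =
    lcmx S , lcmx∈LCM , onto , injective ,
    (λ A B _ B∈S → mk⇔ (lcmx-mono S) (lcmx-reflects-⊆ B∈S)) , lcmx-⁅⁆ S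
    where
    lcmx∈LCM : ∀ C → C ∈F S → InLCM S (lcmx S C)
    lcmx∈LCM C _ = map (x S) (elems C) , map⁺ (All.universal x-MinGen (elems C)) , refl

    onto : ∀ m → InLCM S m → Σ (Subset n) λ C → C ∈F S × lcmx S C ≡ m
    onto m (gs , gs-min , refl) with MinGens⇒xs {S = S} gs-min
    ... | is , refl = closure S ⋃⁅ is ⁆ , join∈ atoms-join , (begin
      lcmx S (closure S ⋃⁅ is ⁆)  ≡⟨ lcmx-join triangle≡x atoms-join ⟩
      lcmx S ⋃⁅ is ⁆              ≡⟨ lcmx-atoms S is ⟩
      lcmList (map (x S) is)      ∎)
      where
      open ≡-Reasoning
      atoms-join : Join S ⋃⁅ is ⁆ (closure S ⋃⁅ is ⁆)
      atoms-join = closure-Join latS ⋃⁅ is ⁆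

    injective : ∀ A B → A ∈F S → B ∈F S → lcmx S A ≡ lcmx S B → A ≡ B
    injective A B A∈S B∈S lcmxA≡lcmxB = ⊆-antisym
      (lcmx-reflects-⊆ B∈S (subst (lcmx S A ∣M_) lcmxA≡lcmxB (∣M-refl {m = lcmx S A})))
      (lcmx-reflects-⊆ A∈S (subst (lcmx S B ∣M_) (sym lcmxA≡lcmxB) (∣M-refl {m = lcmx S B})))

theorem5p3 : ∀ (n : ℕ) (R P Q : Family n) →
    IsAtomicLattice R → IsAtomicLattice P → IsAtomicLattice Q →
    SuperAtomic R → Q ≺L P → P ≤L R → StrongCoord P →
    (StrongCoord Q ⇔ (∀ (k : Fin n) → triangle Q k ≡ x Q k))
theorem5p3 n R P Q latR latP latQ saR (Q≤P , Q≠P , _) P≤R _ =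
  mk⇔ (strongCoord⇒triangle≡x (atom∈ latQ)) (triangle≡x⇒strongCoord latQ separating)
  where
  Q⊆R : Q ⊆F R
  Q⊆R C∈Q = ≤L⇒⊆F latR P≤R (≤L⇒⊆F latP Q≤P C∈Q)

  separating : XSeparating Q
  separating = superAtomic⇒XSeparating latR saR Q⊆R (atom∈ latQ) (another-atom latP latQ Q≠P)
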